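{- Let $m$ be an even positive integer, $q=2^{m/2}$, $r$ a positive integer, $k\ge 0$ an integer, and $u\in\mu_{q+1}$. Then for any $b,c\in\mathbb{F}_{q^2}$, the equation \[ \big(cx^{2^r+1}+bx^{2^r}+1\big)^{q+1}+x^{q+1}=0 \] has a solution $x\in\mathbb{F}_{q^2}$ if and only if the equation \[ \big(c^{2^k}u^{2^k(2^r+1)}x^{2^r+1}+b^{2^k}u^{2^{k+r}}x^{2^r}+1\big)^{q+1}+x^{q+1}=0 \] has a solution $x\in\mathbb{F}_{q^2}$.
   Context: $\mu_{q+1}=\{x^{q-1}: x\in\mathbb{F}_{q^2}^*\}$ is the set of $(q+1)$-th roots of unity in $\mathbb{F}_{q^2}$. -}

module Defs where

open import Level using (Level)
open import Data.Nat using (ℕ; zero; suc)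
open import Data.Fin using (Fin)
open import Data.Product using (Σ; _×_; ∃)
open import Relation.Nullary using (¬_)
open import Relation.Binary.PropositionalEquality as ≡ using (_≡_)
open import Function.Bundles using (Inverse)
open import Algebra.Bundles using (CommutativeRing)

module _ {c ℓ : Level} (R : CommutativeRing c ℓ) where
  open CommutativeRing R

  pow : Carrier → ℕ → Carrier
  pow x zero = 1#
  pow x (suc n) = x * pow x n

  IsField : Set (c Level.⊔ ℓ)
  IsField = (¬ (1# ≈ 0#)) × (∀ x → ¬ (x ≈ 0#) → ∃ λ y → x * y ≈ 1#)

  HasCard : ℕ → Set (c Level.⊔ ℓ)
  HasCard n = Inverse setoid (≡.setoid (Fin n))

  -- μ_{q+1} = { x^(q-1) : x ∈ F* }
  InMu : ℕ → Carrier → Set (c Level.⊔ ℓ)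
  InMu q u = ∃ λ x → (¬ (x ≈ 0#)) × (u ≈ pow x (q Data.Nat.∸ 1))

  HasSol : ℕ → ℕ → Carrier → Carrier → Set (c Level.⊔ ℓ)
  HasSol q r b cc = ∃ λ x →
    pow (cc * pow x (2 Data.Nat.^ r Data.Nat.+ 1) + b * pow x (2 Data.Nat.^ r) + 1#) (q Data.Nat.+ 1)
      + pow x (q Data.Nat.+ 1) ≈ 0#

{-# OPTIONS --safe #-}
-- Since |F| = 2^m is even, F has characteristic 2, so squaring is a ring endomorphism
-- of F; it is injective, and surjective because y = (y^(2^(m-1)))² by Fermat's little
-- theorem.  Applying it k times to the equation and to a solution replaces (b, c) by
-- (b^(2^k), c^(2^k)).  Then v = u^(2^k) still satisfies v^(q+1) = 1, so the substitution
-- x ↦ v x leaves x^(q+1) unchanged and turns the coefficients into b^(2^k) v^(2^r) and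
-- c^(2^k) v^(2^r+1).
module Submission where

open import Defs
open import Level using (Level; _⊔_)
open import Data.Nat using (ℕ; _+_; _*_; _^_; _<_)
open import Relation.Binary.PropositionalEquality using (_≡_)
open import Function.Bundles using (_⇔_)
open import Algebra.Bundles using (CommutativeRing)
open import Algebra.Bundles using (Semiring)

open import Data.Nat using (zero; suc; s≤s; z≤n)
import Data.Nat.Properties as ℕ
open import Data.Nat.Tactic.RingSolver using (solve-∀)
open import Data.Fin as Fin using (Fin; punchIn)
open import Data.Fin.Properties using (punchInᵢ≢i)
open import Data.Fin.Permutation using (Permutation; permutation)
open import Data.Product using (∃; _,_; proj₁; proj₂)
open import Data.Empty using (⊥-elim)
open import Function.Base using (_∘_)
open import Function.Bundles using (Inverse; mk⇔)
open import Function.Properties.Inverse using (Inverse⇒Injection)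
import Function.Properties.Equivalence as ⇔
open import Relation.Nullary using (¬_; Dec; yes; no)
open import Relation.Nullary.Decidable using (via-injection)
open import Relation.Binary.Definitions using (Decidable)
import Relation.Binary.PropositionalEquality as ≡
open import Algebra.Morphism.Structures using (IsSemiringHomomorphism)
import Algebra.Properties.CommutativeSemigroup as CommutativeSemigroupProperties
import Algebra.Properties.CommutativeSemiring.Exp as Exp
import Algebra.Properties.CommutativeMonoid.Sum as Sum
import Algebra.Properties.Ring as RingProperties

m^[2*n]≡m^n*m^n : ∀ m n → m ^ (2 * n) ≡ m ^ n * m ^ n
m^[2*n]≡m^n*m^n m n =
  ≡.trans (ℕ.^-distribˡ-+-* m n (n + 0)) (≡.cong (λ e → m ^ n * m ^ e) (ℕ.+-identityʳ n))

module Powers {a ℓ : Level} (R : CommutativeRing a ℓ) where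
  open CommutativeRing R renaming (_+_ to _⊕_; _*_ to _⊗_)
  open import Relation.Binary.Reasoning.Setoid setoid
  private module E = Exp commutativeSemiring

  pow≡^ : ∀ x n → pow R x n ≡ x E.^ n
  pow≡^ x zero = ≡.refl
  pow≡^ x (suc n) = ≡.cong (x ⊗_) (pow≡^ x n)

  pow-congˡ : ∀ n {x y} → x ≈ y → pow R x n ≈ pow R y n
  pow-congˡ n {x} {y} x≈y rewrite pow≡^ x n | pow≡^ y n = E.^-congˡ n x≈y

  pow-homo-* : ∀ x m n → pow R x (m + n) ≈ pow R x m ⊗ pow R x n
  pow-homo-* x m n rewrite pow≡^ x (m + n) | pow≡^ x m | pow≡^ x n = E.^-homo-* x m n

  pow-assocʳ : ∀ x m n → pow R (pow R x m) n ≈ pow R x (m * n)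
  pow-assocʳ x m n rewrite pow≡^ (pow R x m) n | pow≡^ x m | pow≡^ x (m * n) = E.^-assocʳ x m n

  pow-distrib-* : ∀ x y n → pow R (x ⊗ y) n ≈ pow R x n ⊗ pow R y n
  pow-distrib-* x y n rewrite pow≡^ (x ⊗ y) n | pow≡^ x n | pow≡^ y n = E.^-distrib-* x y n

  pow-1# : ∀ n → pow R 1# n ≈ 1#
  pow-1# zero = refl
  pow-1# (suc n) = trans (*-identityˡ _) (pow-1# n)

  pow-double : ∀ x n → pow R x (2 * n) ≈ pow R x n ⊗ pow R x n
  pow-double x n = begin
    pow R x (n + (n + 0))       ≈⟨ pow-homo-* x n (n + 0) ⟩
    pow R x n ⊗ pow R x (n + 0) ≡⟨ ≡.cong (λ e → pow R x n ⊗ pow R x e) (ℕ.+-identityʳ n) ⟩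
    pow R x n ⊗ pow R x n       ∎

  pow-pow-≈1 : ∀ {u} m n → pow R u n ≈ 1# → pow R (pow R u m) n ≈ 1#
  pow-pow-≈1 {u} m n uⁿ≈1 = begin
    pow R (pow R u m) n ≈⟨ pow-assocʳ u m n ⟩
    pow R u (m * n)     ≡⟨ ≡.cong (pow R u) (ℕ.*-comm m n) ⟩
    pow R u (n * m)     ≈⟨ pow-assocʳ u n m ⟨
    pow R (pow R u n) m ≈⟨ pow-congˡ m uⁿ≈1 ⟩
    pow R 1# m          ≈⟨ pow-1# m ⟩
    1#                  ∎

  ∏ : ∀ {n} → (Fin n → Carrier) → Carrier
  ∏ = Sum.sum *-commutativeMonoid

  ∏-cong : ∀ {n} {f g : Fin n → Carrier} → (∀ i → f i ≈ g i) → ∏ f ≈ ∏ g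
  ∏-cong = Sum.sum-cong-≋ *-commutativeMonoid

  ∏-scale : ∀ {n} y (f : Fin n → Carrier) → ∏ (λ i → y ⊗ f i) ≈ pow R y n ⊗ ∏ f
  ∏-scale {n} y f = begin
    ∏ (λ i → y ⊗ f i)     ≈⟨ Sum.∑-distrib-+ *-commutativeMonoid (λ _ → y) f ⟩
    ∏ {n} (λ _ → y) ⊗ ∏ f ≈⟨ *-congʳ (Sum.sum-replicate *-commutativeMonoid n) ⟩
    y E.^ n ⊗ ∏ f         ≡⟨ ≡.cong (_⊗ ∏ f) (pow≡^ y n) ⟨
    pow R y n ⊗ ∏ f       ∎

module Equation {a ℓ : Level} (R : CommutativeRing a ℓ) (q r : ℕ) where
  open CommutativeRing R renaming (_+_ to _⊕_; _*_ to _⊗_)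
  open Semiring semiring using (rawSemiring)
  open Powers R
  open import Relation.Binary.Reasoning.Setoid setoid

  private variable
    b b′ c c′ v x x′ y : Carrier

  lhs : (b c x : Carrier) → Carrier
  lhs b c x = pow R (c ⊗ pow R x (2 ^ r + 1) ⊕ b ⊗ pow R x (2 ^ r) ⊕ 1#) (q + 1) ⊕ pow R x (q + 1)

  lhs-cong : b ≈ b′ → c ≈ c′ → x ≈ x′ → lhs b c x ≈ lhs b′ c′ x′
  lhs-cong b≈b′ c≈c′ x≈x′ = +-cong
    (pow-congˡ (q + 1) (+-congʳ (+-cong (*-cong c≈c′ (pow-congˡ (2 ^ r + 1) x≈x′))
                                        (*-cong b≈b′ (pow-congˡ (2 ^ r) x≈x′)))))
    (pow-congˡ (q + 1) x≈x′)

  HasSol-cong : b ≈ b′ → c ≈ c′ → HasSol R q r b c ⇔ HasSol R q r b′ c′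
  HasSol-cong b≈b′ c≈c′ = mk⇔
    (λ (x , e) → x , trans (lhs-cong (sym b≈b′) (sym c≈c′) refl) e)
    (λ (x , e) → x , trans (lhs-cong b≈b′ c≈c′ refl) e)

  lhs-scale : pow R v (q + 1) ≈ 1# →
    lhs b c (v ⊗ y) ≈ lhs (b ⊗ pow R v (2 ^ r)) (c ⊗ pow R v (2 ^ r + 1)) y
  lhs-scale {v} {b} {c} {y} v^[q+1]≈1 = +-cong
    (pow-congˡ (q + 1) (+-congʳ (+-cong (scaled c (2 ^ r + 1)) (scaled b (2 ^ r)))))
    (begin
      pow R (v ⊗ y) (q + 1)             ≈⟨ pow-distrib-* v y (q + 1) ⟩
      pow R v (q + 1) ⊗ pow R y (q + 1) ≈⟨ *-congʳ v^[q+1]≈1 ⟩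
      1# ⊗ pow R y (q + 1)              ≈⟨ *-identityˡ _ ⟩
      pow R y (q + 1)                   ∎)
    where
    scaled : ∀ z n → z ⊗ pow R (v ⊗ y) n ≈ (z ⊗ pow R v n) ⊗ pow R y n
    scaled z n = trans (*-congˡ (pow-distrib-* v y n)) (sym (*-assoc z _ _))

  HasSol-scale : pow R v (q + 1) ≈ 1# →
    HasSol R q r b c ⇔ HasSol R q r (b ⊗ pow R v (2 ^ r)) (c ⊗ pow R v (2 ^ r + 1))
  HasSol-scale {v} {b} {c} v^[q+1]≈1 = mk⇔
    (λ (x , e) → pow R v q ⊗ x ,
       trans (sym (lhs-scale {b = b} {c} v^[q+1]≈1)) (trans (lhs-cong refl refl (unscale x)) e))
    (λ (y , e) → v ⊗ y , trans (lhs-scale v^[q+1]≈1) e)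
    where
    unscale : ∀ x → v ⊗ (pow R v q ⊗ x) ≈ x
    unscale x = begin
      v ⊗ (pow R v q ⊗ x) ≈⟨ *-assoc v _ x ⟨
      pow R v (1 + q) ⊗ x ≡⟨ ≡.cong (λ e → pow R v e ⊗ x) (ℕ.+-comm 1 q) ⟩
      pow R v (q + 1) ⊗ x ≈⟨ *-congʳ v^[q+1]≈1 ⟩
      1# ⊗ x              ≈⟨ *-identityˡ x ⟩
      x                   ∎

  module _ {φ : Carrier → Carrier} (φ-hom : IsSemiringHomomorphism rawSemiring rawSemiring φ) where
    open IsSemiringHomomorphism φ-hom

    φ-pow : ∀ x n → φ (pow R x n) ≈ pow R (φ x) n
    φ-pow x zero = 1#-homo
    φ-pow x (suc n) = trans (*-homo x _) (*-congˡ (φ-pow x n))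

    φ-lhs : φ (lhs b c x) ≈ lhs (φ b) (φ c) (φ x)
    φ-lhs {b} {c} {x} = trans (+-homo _ _)
      (+-cong (trans (φ-pow _ (q + 1)) (pow-congˡ (q + 1) φ-poly)) (φ-pow x (q + 1)))
      where
      φ-monomial : ∀ z n → φ (z ⊗ pow R x n) ≈ φ z ⊗ pow R (φ x) n
      φ-monomial z n = trans (*-homo z _) (*-congˡ (φ-pow x n))
      φ-poly : φ (c ⊗ pow R x (2 ^ r + 1) ⊕ b ⊗ pow R x (2 ^ r) ⊕ 1#)
             ≈ φ c ⊗ pow R (φ x) (2 ^ r + 1) ⊕ φ b ⊗ pow R (φ x) (2 ^ r) ⊕ 1#
      φ-poly = trans (+-homo _ _)
        (+-cong (trans (+-homo _ _) (+-cong (φ-monomial c (2 ^ r + 1)) (φ-monomial b (2 ^ r)))) 1#-homo)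

    HasSol-endo : (∀ {z} → φ z ≈ 0# → z ≈ 0#) → (∀ y → ∃ λ x → φ x ≈ y) →
      HasSol R q r b c ⇔ HasSol R q r (φ b) (φ c)
    HasSol-endo kernel-trivial surjective = mk⇔
      (λ (x , e) → φ x , trans (sym φ-lhs) (trans (⟦⟧-cong e) 0#-homo))
      (λ (y , e) → let (x , φx≈y) = surjective y in
        x , kernel-trivial (trans φ-lhs (trans (lhs-cong refl refl φx≈y) e)))

  module Characteristic2 (1+1≈0 : 1# ⊕ 1# ≈ 0#) where
    x+x≈0 : ∀ x → x ⊕ x ≈ 0#
    x+x≈0 x = begin
      x ⊕ x           ≈⟨ +-cong (*-identityˡ x) (*-identityˡ x) ⟨
      1# ⊗ x ⊕ 1# ⊗ x ≈⟨ distribʳ x 1# 1# ⟨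
      (1# ⊕ 1#) ⊗ x   ≈⟨ *-congʳ 1+1≈0 ⟩
      0# ⊗ x          ≈⟨ zeroˡ x ⟩
      0#              ∎

    square-+ : ∀ x y → (x ⊕ y) ⊗ (x ⊕ y) ≈ x ⊗ x ⊕ y ⊗ y
    square-+ x y = begin
      (x ⊕ y) ⊗ (x ⊕ y)                 ≈⟨ distribʳ _ x y ⟩
      x ⊗ (x ⊕ y) ⊕ y ⊗ (x ⊕ y)         ≈⟨ +-cong (distribˡ x x y) (distribˡ y x y) ⟩
      (x ⊗ x ⊕ x ⊗ y) ⊕ (y ⊗ x ⊕ y ⊗ y) ≈⟨ +-congˡ (+-congʳ (*-comm y x)) ⟩
      (x ⊗ x ⊕ x ⊗ y) ⊕ (x ⊗ y ⊕ y ⊗ y) ≈⟨ +-assoc _ _ _ ⟩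
      x ⊗ x ⊕ (x ⊗ y ⊕ (x ⊗ y ⊕ y ⊗ y)) ≈⟨ +-congˡ (+-assoc _ _ _) ⟨
      x ⊗ x ⊕ ((x ⊗ y ⊕ x ⊗ y) ⊕ y ⊗ y) ≈⟨ +-congˡ (+-congʳ (x+x≈0 _)) ⟩
      x ⊗ x ⊕ (0# ⊕ y ⊗ y)              ≈⟨ +-congˡ (+-identityˡ _) ⟩
      x ⊗ x ⊕ y ⊗ y                     ∎

    square-isSemiringHomomorphism : IsSemiringHomomorphism rawSemiring rawSemiring (λ x → x ⊗ x)
    square-isSemiringHomomorphism = record
      { isNearSemiringHomomorphism = record
        { +-isMonoidHomomorphism = record
          { isMagmaHomomorphism = record
            { isRelHomomorphism = record { cong = λ x≈y → *-cong x≈y x≈y }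
            ; homo = square-+
            }
          ; ε-homo = zeroˡ 0#
          }
        ; *-homo = λ x y → CommutativeSemigroupProperties.interchange *-commutativeSemigroup x y x y
        }
      ; 1#-homo = *-identityˡ 1#
      }

    HasSol-frobenius : (∀ {z} → z ⊗ z ≈ 0# → z ≈ 0#) → (∀ y → ∃ λ x → x ⊗ x ≈ y) →
      ∀ k → HasSol R q r b c ⇔ HasSol R q r (pow R b (2 ^ k)) (pow R c (2 ^ k))
    HasSol-frobenius {b = b} {c} _ _ zero = HasSol-cong (sym (*-identityʳ b)) (sym (*-identityʳ c))
    HasSol-frobenius {b = b} {c} kernel-trivial surjective (suc k) =
      ⇔.trans (HasSol-frobenius kernel-trivial surjective k)
      (⇔.trans (HasSol-endo square-isSemiringHomomorphism kernel-trivial surjective)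
               (HasSol-cong (sym (pow-double b (2 ^ k))) (sym (pow-double c (2 ^ k)))))

module FiniteField {a ℓ : Level} (F : CommutativeRing a ℓ) (isField : IsField F) where
  open CommutativeRing F renaming (_+_ to _⊕_; _*_ to _⊗_)
  open Powers F
  open RingProperties ring using (-1*x≈-x; -‿involutive)
  open import Algebra.Definitions _≈_ using (Congruent₁)
  open import Relation.Binary.Reasoning.Setoid setoid

  private variable
    N n t : ℕ
    x y z : Carrier

  *-cancelˡ : ¬ (x ≈ 0#) → x ⊗ y ≈ x ⊗ z → y ≈ z
  *-cancelˡ {x} {y} {z} x≉0 xy≈xz = begin
    y               ≈⟨ *-identityˡ y ⟨
    1# ⊗ y          ≈⟨ *-congʳ x⁻¹x≈1 ⟨
    (x⁻¹ ⊗ x) ⊗ y   ≈⟨ *-assoc x⁻¹ x y ⟩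
    x⁻¹ ⊗ (x ⊗ y)   ≈⟨ *-congˡ xy≈xz ⟩
    x⁻¹ ⊗ (x ⊗ z)   ≈⟨ *-assoc x⁻¹ x z ⟨
    (x⁻¹ ⊗ x) ⊗ z   ≈⟨ *-congʳ x⁻¹x≈1 ⟩
    1# ⊗ z          ≈⟨ *-identityˡ z ⟩
    z               ∎
    where
    x⁻¹ : Carrier
    x⁻¹ = proj₁ (proj₂ isField x x≉0)
    x⁻¹x≈1 : x⁻¹ ⊗ x ≈ 1#
    x⁻¹x≈1 = trans (*-comm x⁻¹ x) (proj₂ (proj₂ isField x x≉0))

  *-≉0 : ¬ (x ≈ 0#) → ¬ (y ≈ 0#) → ¬ (x ⊗ y ≈ 0#)
  *-≉0 {x} x≉0 y≉0 xy≈0 = y≉0 (*-cancelˡ x≉0 (trans xy≈0 (sym (zeroʳ x))))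

  ∏-≉0 : (f : Fin n → Carrier) → (∀ i → ¬ (f i ≈ 0#)) → ¬ (∏ f ≈ 0#)
  ∏-≉0 {zero} f _ = proj₁ isField
  ∏-≉0 {suc n} f f≉0 = *-≉0 (f≉0 Fin.zero) (∏-≉0 (f ∘ Fin.suc) (f≉0 ∘ Fin.suc))

  ¬HasCard-0 : ¬ HasCard F 0
  ¬HasCard-0 card with Inverse.to card 0#
  ... | ()

  ≈-dec : HasCard F N → Decidable _≈_
  ≈-dec card = via-injection (Inverse⇒Injection card) Fin._≟_

  -- Multiplication by y ≉ 0 permutes the nonzero elements, so their product P
  -- satisfies P = yⁿ P.  To use the permutation of the whole of F given by the
  -- enumeration, the product is taken over F with 0 replaced by 1.
  module Fermat (card : HasCard F (suc n)) where
    open Inverse card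

    zeroToOne : Carrier → Carrier
    zeroToOne x with ≈-dec card x 0#
    ... | yes _ = 1#
    ... | no _ = x

    zeroToOne-0 : x ≈ 0# → zeroToOne x ≈ 1#
    zeroToOne-0 {x} x≈0 with ≈-dec card x 0#
    ... | yes _ = refl
    ... | no x≉0 = ⊥-elim (x≉0 x≈0)

    zeroToOne-≉0 : ¬ (x ≈ 0#) → zeroToOne x ≈ x
    zeroToOne-≉0 {x} x≉0 with ≈-dec card x 0#
    ... | yes x≈0 = ⊥-elim (x≉0 x≈0)
    ... | no _ = refl

    zeroToOne-cong : Congruent₁ zeroToOne
    zeroToOne-cong {x} {y} x≈y = cases (≈-dec card y 0#)
      where
      cases : Dec (y ≈ 0#) → zeroToOne x ≈ zeroToOne y
      cases (yes y≈0) = trans (zeroToOne-0 (trans x≈y y≈0)) (sym (zeroToOne-0 y≈0))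
      cases (no y≉0) = trans (zeroToOne-≉0 (λ x≈0 → y≉0 (trans (sym x≈y) x≈0)))
                             (trans x≈y (sym (zeroToOne-≉0 y≉0)))

    ∏F : (Carrier → Carrier) → Carrier
    ∏F f = ∏ (f ∘ from)

    nonzero : Fin n → Carrier
    nonzero = from ∘ punchIn (to 0#)

    nonzero-≉0 : ∀ j → ¬ (nonzero j ≈ 0#)
    nonzero-≉0 j e = punchInᵢ≢i (to 0#) j (≡.trans (≡.sym (strictlyInverseˡ _)) (to-cong e))

    ∏F-split : ∀ {f} → Congruent₁ f → ∏F f ≈ f 0# ⊗ ∏ (f ∘ nonzero)
    ∏F-split {f} f-cong =
      trans (Sum.sum-remove *-commutativeMonoid {i = to 0#} (f ∘ from)) (*-congʳ (f-cong (strictlyInverseʳ 0#)))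

    ∏F-invariant : ∀ {f} → ¬ (y ≈ 0#) → Congruent₁ f → ∏F f ≈ ∏F (λ x → f (y ⊗ x))
    ∏F-invariant {y} {f} y≉0 f-cong = trans (Sum.sum-permute *-commutativeMonoid (f ∘ from) π)
      (∏-cong (λ i → f-cong (strictlyInverseʳ (y ⊗ from i))))
      where
      y⁻¹ : Carrier
      y⁻¹ = proj₁ (proj₂ isField y y≉0)
      yy⁻¹≈1 : y ⊗ y⁻¹ ≈ 1#
      yy⁻¹≈1 = proj₂ (proj₂ isField y y≉0)
      mul : Carrier → Fin (suc n) → Fin (suc n)
      mul s i = to (s ⊗ from i)
      mul-inverse : ∀ {s t} → s ⊗ t ≈ 1# → ∀ i → mul s (mul t i) ≡ i
      mul-inverse {s} {t} st≈1 i = ≡.trans (to-cong (begin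
        s ⊗ from (to (t ⊗ from i)) ≈⟨ *-congˡ (strictlyInverseʳ _) ⟩
        s ⊗ (t ⊗ from i)           ≈⟨ *-assoc s t _ ⟨
        (s ⊗ t) ⊗ from i           ≈⟨ *-congʳ st≈1 ⟩
        1# ⊗ from i                ≈⟨ *-identityˡ _ ⟩
        from i                     ∎)) (strictlyInverseˡ i)
      π : Permutation (suc n) (suc n)
      π = permutation (mul y) (mul y⁻¹) (mul-inverse yy⁻¹≈1) (mul-inverse (trans (*-comm y⁻¹ y) yy⁻¹≈1))

    ∏F-zeroToOne : ∏F zeroToOne ≈ ∏ nonzero
    ∏F-zeroToOne = begin
      ∏F zeroToOne                           ≈⟨ ∏F-split zeroToOne-cong ⟩
      zeroToOne 0# ⊗ ∏ (zeroToOne ∘ nonzero) ≈⟨ *-cong (zeroToOne-0 refl) (∏-cong (zeroToOne-≉0 ∘ nonzero-≉0)) ⟩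
      1# ⊗ ∏ nonzero                         ≈⟨ *-identityˡ _ ⟩
      ∏ nonzero                              ∎

    ∏F-zeroToOne-scaled : ¬ (y ≈ 0#) → ∏F (λ x → zeroToOne (y ⊗ x)) ≈ pow F y n ⊗ ∏ nonzero
    ∏F-zeroToOne-scaled {y} y≉0 = begin
      ∏F (λ x → zeroToOne (y ⊗ x))
        ≈⟨ ∏F-split (zeroToOne-cong ∘ *-congˡ) ⟩
      zeroToOne (y ⊗ 0#) ⊗ ∏ (λ j → zeroToOne (y ⊗ nonzero j))
        ≈⟨ *-cong (zeroToOne-0 (zeroʳ y)) (∏-cong (zeroToOne-≉0 ∘ *-≉0 y≉0 ∘ nonzero-≉0)) ⟩
      1# ⊗ ∏ (λ j → y ⊗ nonzero j)
        ≈⟨ *-identityˡ _ ⟩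
      ∏ (λ j → y ⊗ nonzero j)
        ≈⟨ ∏-scale y nonzero ⟩
      pow F y n ⊗ ∏ nonzero
        ∎

    pow-pred-card≈1 : ¬ (y ≈ 0#) → pow F y n ≈ 1#
    pow-pred-card≈1 {y} y≉0 = sym (*-cancelˡ (∏-≉0 nonzero nonzero-≉0) (begin
      ∏ nonzero ⊗ 1#                ≈⟨ *-identityʳ _ ⟩
      ∏ nonzero                     ≈⟨ ∏F-zeroToOne ⟨
      ∏F zeroToOne                  ≈⟨ ∏F-invariant y≉0 zeroToOne-cong ⟩
      ∏F (λ x → zeroToOne (y ⊗ x))  ≈⟨ ∏F-zeroToOne-scaled y≉0 ⟩
      pow F y n ⊗ ∏ nonzero         ≈⟨ *-comm _ _ ⟩
      ∏ nonzero ⊗ pow F y n         ∎))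

  open Fermat using (pow-pred-card≈1)

  pow-card≈id : HasCard F N → ∀ x → pow F x N ≈ x
  pow-card≈id {zero} card x = ⊥-elim (¬HasCard-0 card)
  pow-card≈id {suc n} card x with ≈-dec card x 0#
  ... | yes x≈0 = trans (*-congʳ x≈0) (trans (zeroˡ _) (sym x≈0))
  ... | no x≉0 = trans (*-congˡ (pow-pred-card≈1 card x≉0)) (*-identityʳ x)

  1+1≈0 : HasCard F (2 * t) → 1# ⊕ 1# ≈ 0#
  1+1≈0 {t} card = begin
    1# ⊕ 1#   ≈⟨ +-congʳ 1≈-1 ⟩
    - 1# ⊕ 1# ≈⟨ -‿inverseˡ 1# ⟩
    0#        ∎
    where
    1≈-1 : 1# ≈ - 1#
    1≈-1 = begin
      1#                              ≈⟨ pow-1# t ⟨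
      pow F 1# t                      ≈⟨ pow-congˡ t (trans (-1*x≈-x (- 1#)) (-‿involutive 1#)) ⟨
      pow F (- 1# ⊗ - 1#) t           ≈⟨ pow-distrib-* (- 1#) (- 1#) t ⟩
      pow F (- 1#) t ⊗ pow F (- 1#) t ≈⟨ pow-double (- 1#) t ⟨
      pow F (- 1#) (2 * t)            ≈⟨ pow-card≈id card (- 1#) ⟩
      - 1#                            ∎

  square≈0⇒≈0 : HasCard F N → x ⊗ x ≈ 0# → x ≈ 0#
  square≈0⇒≈0 {x = x} card x²≈0 with ≈-dec card x 0#
  ... | yes x≈0 = x≈0
  ... | no x≉0 = ⊥-elim (*-≉0 x≉0 x≉0 x²≈0)

  square-surjective : HasCard F (2 * t) → ∀ y → ∃ λ x → x ⊗ x ≈ y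
  square-surjective {t} card y = pow F y t , trans (sym (pow-double y t)) (pow-card≈id card y)

  μ-pow[q+1]≈1 : ∀ q {u} → HasCard F (q * q) → InMu F q u → pow F u (q + 1) ≈ 1#
  μ-pow[q+1]≈1 zero card _ = ⊥-elim (¬HasCard-0 card)
  μ-pow[q+1]≈1 (suc p) {u} card (x , x≉0 , u≈xᵖ) = begin
    pow F u (suc p + 1)           ≈⟨ pow-congˡ (suc p + 1) u≈xᵖ ⟩
    pow F (pow F x p) (suc p + 1) ≈⟨ pow-assocʳ x p (suc p + 1) ⟩
    pow F x (p * (suc p + 1))     ≈⟨ pow-pred-card≈1 (≡.subst (HasCard F) (suc-square p) card) x≉0 ⟩
    1#                            ∎
    where
    suc-square : ∀ p → suc p * suc p ≡ suc (p * (suc p + 1))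
    suc-square = solve-∀

proposition4p3 : {a ℓ : Level} (m h : ℕ) → m ≡ 2 * h → 0 < m →
    (F : CommutativeRing a ℓ) → IsField F → HasCard F (2 ^ m) →
    (r : ℕ) → 0 < r → (k : ℕ) →
    (u : CommutativeRing.Carrier F) → InMu F (2 ^ h) u →
    (b c : CommutativeRing.Carrier F) →
    HasSol F (2 ^ h) r b c
      ⇔ HasSol F (2 ^ h) r
          (CommutativeRing._*_ F (pow F b (2 ^ k)) (pow F u (2 ^ (k + r))))
          (CommutativeRing._*_ F (pow F c (2 ^ k)) (pow F u ((2 ^ k) * (2 ^ r + 1))))
proposition4p3 {a} {ℓ} (suc m′) h m≡2h (s≤s z≤n) F isField card r _ k u u∈μ b c = begin
  HasSol F q r b c
    ≈⟨ HasSol-frobenius (square≈0⇒≈0 card) (square-surjective {2 ^ m′} card) k ⟩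
  HasSol F q r (pow F b (2 ^ k)) (pow F c (2 ^ k))
    ≈⟨ HasSol-scale v^[q+1]≈1 ⟩
  HasSol F q r (pow F b (2 ^ k) ⊗ pow F v (2 ^ r)) (pow F c (2 ^ k) ⊗ pow F v (2 ^ r + 1))
    ≈⟨ HasSol-cong (*-congˡ v^[2^r]≈u^[2^[k+r]]) (*-congˡ (pow-assocʳ u (2 ^ k) (2 ^ r + 1))) ⟩
  HasSol F q r (pow F b (2 ^ k) ⊗ pow F u (2 ^ (k + r))) (pow F c (2 ^ k) ⊗ pow F u (2 ^ k * (2 ^ r + 1)))
    ∎
  where
  open CommutativeRing F using (Carrier; _≈_; 1#; trans; reflexive; *-congˡ) renaming (_*_ to _⊗_)
  open Powers F
  open FiniteField F isField
  q : ℕ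
  q = 2 ^ h
  open Equation F q r
  open Characteristic2 (1+1≈0 {2 ^ m′} card)
  open import Relation.Binary.Reasoning.Setoid (⇔.⇔-setoid (a ⊔ ℓ))

  v : Carrier
  v = pow F u (2 ^ k)

  v^[q+1]≈1 : pow F v (q + 1) ≈ 1#
  v^[q+1]≈1 = pow-pow-≈1 (2 ^ k) (q + 1) (μ-pow[q+1]≈1 q card′ u∈μ)
    where
    card′ : HasCard F (q * q)
    card′ = ≡.subst (HasCard F) (≡.trans (≡.cong (2 ^_) m≡2h) (m^[2*n]≡m^n*m^n 2 h)) card

  v^[2^r]≈u^[2^[k+r]] : pow F v (2 ^ r) ≈ pow F u (2 ^ (k + r))
  v^[2^r]≈u^[2^[k+r]] = trans (pow-assocʳ u (2 ^ k) (2 ^ r))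
    (reflexive (≡.cong (pow F u) (≡.sym (ℕ.^-distribˡ-+-* 2 k r))))
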